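{- Let $\mathcal{G}$ be a game with set of states $S$ and Borel objective $\Omega$, let $S_1,\dots,S_n$ be a partition of the states controlled by $\mathtt{Sat}$, and let $I\subseteq\{1,\dots,n\}$ be such that $I(S_j)=0$ for every $j\notin I$. Then for every $i\in I$, \[ I(S_i)=\frac{1}{|I|!}\sum_{\pi\in\Pi_I}\Big(\mathrm{val}(S^\pi_{\ge i})-\mathrm{val}(S^\pi_{\ge i}\setminus S_i)\Big),\] where $\Pi_I$ is the set of bijections $\pi:I\to\{1,\dots,|I|\}$ and, for $\pi\in\Pi_I$, $S^\pi_{\ge i}=\bigcup_{j\in I,\ \pi(j)\ge\pi(i)}S_j$.
   Context: A game is given by a finite directed graph $(S,\Delta)$ in which every state has at least one successor, a partition of $S$ into $S_{\mathtt{Sat}}$ and $S_{\mathtt{Unsat}}$, an initial state $init$, and a Borel objective $\Omega\subseteq S^\omega$. Plays are infinite paths from $init$; strategies map finite histories ending in the player's own states to successors; $\mathtt{Sat}$ wins a play iff it lies in $\Omega$. For $T\subseteq S$, $\mathcal{G}_T$ is the game on the same graph, initial state and objective in which $\mathtt{Sat}$ controls $T$ and $\mathtt{Unsat}$ controls $S\setminus T$; $\mathrm{val}(T)=1$ if $\mathtt{Sat}$ has a winning strategy in $\mathcal{G}_T$, and $0$ otherwise. Given a partition $S_1,\dots,S_n$ of $S_{\mathtt{Sat}}$, the importance of $S_i$ is $I(S_i)=\frac{1}{n!}\sum_{\pi\in\Pi_n}\big(\mathrm{val}(S^\pi_{\ge i})-\mathrm{val}(S^\pi_{\ge i}\setminus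 S_i)\big)$, where $\Pi_n$ is the set of permutations of $\{1,\dots,n\}$ and $S^\pi_{\ge i}=\bigcup_{1\le j\le n,\ \pi(j)\ge\pi(i)}S_j$. -}

module Defs where

open import Data.Nat using (ℕ; zero; suc; _!; NonZero)
open import Data.Nat.Properties using (_!≢0)
open import Data.Bool using (Bool; true; false; _∧_; not; if_then_else_)
open import Data.Fin using (Fin; _≟_; _≤?_)
open import Data.Fin.Subset using (Subset)
open import Data.Maybe using (Maybe; just; nothing)
open import Data.List using (List; []; _∷_; map; concatMap; filterᵇ; length; upTo; allFin; foldr)
open import Data.Bool.ListAction using (all)
open import Data.Vec using (lookup)
import Data.Vec.Functional as VF
open import Data.Integer using (ℤ; _-_; 0ℤ; 1ℤ) renaming (_+_ to _+ℤ_)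
open import Data.Rational using (ℚ; _/_)
open import Data.Product using (Σ; ∃; _×_; _,_)
open import Data.Sum using (_⊎_)
open import Function using (_⇔_; _∘_)
open import Relation.Nullary using (¬_; ⌊_⌋)
open import Relation.Binary.PropositionalEquality using (_≡_)

Seq : ℕ → Set
Seq m = ℕ → Fin m

prefix : ∀ {m} → Seq m → ℕ → List (Fin m)
prefix ρ k = map ρ (upTo k)

-- Borel subsets of S^ω (product topology): generated by cylinder sets
-- under complement and countable union.

data BorelCode (m : ℕ) : Set where
  cyl   : List (Fin m) → BorelCode m
  compl : BorelCode m → BorelCode m
  union : (ℕ → BorelCode m) → BorelCode m

⟦_⟧ : ∀ {m} → BorelCode m → Seq m → Set
⟦ cyl w   ⟧ ρ = prefix ρ (length w) ≡ w
⟦ compl b ⟧ ρ = ¬ ⟦ b ⟧ ρ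
⟦ union f ⟧ ρ = ∃ λ k → ⟦ f k ⟧ ρ

IsBorel : ∀ {m} → (Seq m → Set) → Set
IsBorel {m} Ω = Σ (BorelCode m) λ b → ∀ ρ → Ω ρ ⇔ ⟦ b ⟧ ρ

record Game (m : ℕ) : Set₁ where
  field
    Δ        : Fin m → Fin m → Bool
    total    : ∀ s → ∃ λ t → Δ s t ≡ true
    SatState : Fin m → Bool                  -- true: S_Sat, false: S_Unsat
    init     : Fin m
    Ω        : Seq m → Set
    Ω-borel  : IsBorel Ω

module _ {m : ℕ} (G : Game m) where
  open Game G

  IsPlay : Seq m → Set
  IsPlay ρ = (ρ 0 ≡ init) × (∀ k → Δ (ρ k) (ρ (suc k)) ≡ true)

  -- a strategy maps a finite history (given as the list of earlier
  -- states together with the current last state) to a successor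
  Strategy : Set
  Strategy = List (Fin m) → Fin m → Fin m

  Legal : (Fin m → Bool) → Strategy → Set
  Legal T σ = ∀ h s → T s ≡ true → Δ s (σ h s) ≡ true

  Consistent : (Fin m → Bool) → Strategy → Seq m → Set
  Consistent T σ ρ = ∀ k → T (ρ k) ≡ true → ρ (suc k) ≡ σ (prefix ρ k) (ρ k)

  -- Sat has a winning strategy in G_T (Sat controls T, Unsat the rest):
  -- every play consistent with σ (whatever Unsat does) lies in Ω
  SatWins : (Fin m → Bool) → Set
  SatWins T = Σ Strategy λ σ → Legal T σ × (∀ ρ → IsPlay ρ → Consistent T σ ρ → Ω ρ)

  IsVal : ((Fin m → Bool) → ℤ) → Set
  IsVal val = ∀ T → (val T ≡ 1ℤ × SatWins T) ⊎ (val T ≡ 0ℤ × ¬ SatWins T)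

-- Partition of S_Sat into blocks S_1 … S_n :
-- block s = just j  means s ∈ S_j ;  block s = nothing  means s ∈ S_Unsat.

IsPartition : ∀ {m n} → Game m → (Fin m → Maybe (Fin n)) → Set
IsPartition {m} {n} G block =
    (∀ s → Game.SatState G s ≡ true ⇔ (∃ λ j → block s ≡ just j))
  × (∀ (j : Fin n) → ∃ λ s → block s ≡ just j)

allFuns : ∀ {A : Set} (n : ℕ) → List A → List (Fin n → A)
allFuns zero    xs = (λ ()) ∷ []
allFuns (suc n) xs = concatMap (λ x → map (λ f → x VF.∷ f) (allFuns n xs)) xs

allMaybe : ∀ k → List (Maybe (Fin k))
allMaybe k = nothing ∷ map just (allFin k)

sumℤ : List ℤ → ℤ
sumℤ = foldr _+ℤ_ 0ℤ

maybeEq : ∀ {k} → Maybe (Fin k) → Maybe (Fin k) → Bool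
maybeEq (just a) (just b) = ⌊ a ≟ b ⌋
maybeEq _        _        = false

isJust : ∀ {A : Set} → Maybe A → Bool
isJust (just _) = true
isJust nothing  = false

-- Π_n : permutations π of {1,…,n} (here Fin n), i.e. injective maps Fin n → Fin n
isInjective : ∀ {n k} → (Fin n → Fin k) → Bool
isInjective {n} f =
  all (λ a → all (λ b → if ⌊ f a ≟ f b ⌋ then ⌊ a ≟ b ⌋ else true) (allFin n)) (allFin n)

Perms : (n : ℕ) → List (Fin n → Fin n)
Perms n = filterᵇ isInjective (allFuns n (allFin n))

-- Π_I : bijections π : I → {1,…,|I|}, represented as r : Fin n → Maybe (Fin k)
-- (k = |I|) with r j = just (π j) for j ∈ I and r j = nothing for j ∉ I,
-- injective on I (hence bijective onto Fin k, since |I| = k).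
isBijOn : ∀ {n k} → Subset n → (Fin n → Maybe (Fin k)) → Bool
isBijOn {n} I r =
     all (λ j → if lookup I j then isJust (r j) else not (isJust (r j))) (allFin n)
  ∧ all (λ a → all (λ b → if maybeEq (r a) (r b) then ⌊ a ≟ b ⌋ else true) (allFin n)) (allFin n)

BijsOn : ∀ {n} (I : Subset n) (k : ℕ) → List (Fin n → Maybe (Fin k))
BijsOn {n} I k = filterᵇ (isBijOn I) (allFuns n (allMaybe k))

-- S^π_{≥ i} for a (partial) ranking r (π(j) = a iff r j = just a):
-- the union of the S_j with r j defined and r j ≥ r i.

geq : ∀ {k} → Maybe (Fin k) → Maybe (Fin k) → Bool
geq (just a) (just b) = ⌊ b ≤? a ⌋
geq _        _        = false

upSet : ∀ {m n k} → (Fin m → Maybe (Fin n)) → (Fin n → Maybe (Fin k)) → Fin n → Fin m → Bool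
upSet block r i s with block s
... | just j  = geq (r j) (r i)
... | nothing = false

upSetMinus : ∀ {m n k} → (Fin m → Maybe (Fin n)) → (Fin n → Maybe (Fin k)) → Fin n → Fin m → Bool
upSetMinus block r i s with block s
... | just j  = geq (r j) (r i) ∧ not ⌊ j ≟ i ⌋
... | nothing = false

marginal : ∀ {m n k} → ((Fin m → Bool) → ℤ) → (Fin m → Maybe (Fin n))
         → (Fin n → Maybe (Fin k)) → Fin n → ℤ
marginal val block r i = val (upSet block r i) - val (upSetMinus block r i)

importance : ∀ {m n} → ((Fin m → Bool) → ℤ) → (Fin m → Maybe (Fin n)) → Fin n → ℚ
importance {n = n} val block i =
  _/_ (sumℤ (map (λ π → marginal val block (just ∘ π) i) (Perms n))) (n !) {{n !≢0}}

importanceOn : ∀ {m n} → ((Fin m → Bool) → ℤ) → (Fin m → Maybe (Fin n))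
             → (I : Subset n) → (k : ℕ) → Fin n → ℚ
importanceOn val block I k i =
  _/_ (sumℤ (map (λ r → marginal val block r i) (BijsOn I k))) (k !) {{k !≢0}}

-- A block d of importance zero is a dummy: the marginals val(S^π_{≥d}) − val(S^π_{≥d} ∖ S_d) are
-- non-negative (Sat only gains from controlling more states), so all of them vanish, and every set of
-- blocks containing d is S^π_{≥d} for some permutation π; hence removing S_d never changes val.
-- Deleting a dummy d ≠ i from a ranking (closing the gap it leaves) therefore does not change the
-- marginal of i, and each ranking of a support without d comes, by this deletion, from exactly k + 1
-- rankings of the support with d, one for each position of d. Deleting the dummies one at a time
-- turns the sum over the n! permutations into n! / |I|! times the sum over the bijections Π_I.
module Submission where

open import Algebra.Properties.CommutativeSemigroup using (interchange)
open import Data.Bool using (Bool; true; false; _∧_; _∨_; not; if_then_else_; T)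
open import Data.Bool.ListAction using (and; all)
open import Data.Bool.Properties using (T-≡; T-∧; ∧-zeroʳ; ∧-identityʳ; ∧-assoc; ∧-comm; ∨-zeroʳ; ∨-identityʳ)
open import Data.Fin as Fin using (Fin; zero; suc)
import Data.Fin.Properties as Fin
open import Data.Fin.Subset using (Subset; _∈_; _∉_; _⊂_; ∣_∣)
open import Data.Fin.Subset.Properties using (p⊂q⇒∣p∣<∣q∣; ∣⊤∣≡n; ⊆⊤; ∈⊤)
open import Data.Integer as ℤ using (ℤ; +_; 0ℤ; 1ℤ; _+_; _*_; _-_)
open import Data.Integer.Properties
  using (+-identityˡ; +-assoc; *-identityˡ; *-identityʳ; *-zeroʳ; *-comm; *-assoc; *-distribˡ-+; *-distribʳ-+;
         pos-*; ≤-refl; ≤-reflexive; ≤-trans; ≤-antisym; +-mono-≤; i≤j⇒0≤j-i; i-j≡0⇒i≡j; +-commutativeSemigroup)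
open import Data.List using (List; []; _∷_; _++_; map; concatMap; filterᵇ; foldr; length; allFin)
open import Data.List.Properties using (map-cong; map-tabulate; length-tabulate; length-map)
open import Data.List.Relation.Unary.All as All using (All; []; _∷_)
import Data.List.Relation.Unary.All.Properties as All
open import Data.List.Relation.Unary.Any as Any using (Any; here; there)
import Data.List.Relation.Unary.Any.Properties as Any
open import Data.List.Relation.Unary.Unique.Propositional using (Unique; []; _∷_)
import Data.List.Relation.Unary.Unique.Propositional.Properties as Unique
open import Data.Maybe as Maybe using (Maybe; just; nothing)
import Data.Maybe.Properties as Maybe
open import Data.Maybe.Properties using (just-injective)
open import Data.Nat as ℕ using (ℕ; zero; suc; _!; z≤n)
open import Data.Nat.DivMod using (_%_; [m+kn]%n≡m%n; m<n⇒m%n≡m)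
import Data.Nat.Properties as ℕ
open import Data.Nat.Properties using (_!≢0)
open import Data.Product using (∃; _×_; _,_; proj₁; proj₂)
open import Data.Rational using (0ℚ; _/_)
open import Data.Rational.Properties using (fromℚᵘ-cong; fromℚᵘ-injective)
open import Data.Rational.Unnormalised using (mkℚᵘ; *≡*)
open import Data.Sum using (_⊎_; inj₁; inj₂)
open import Data.Vec using ([]; _∷_; lookup)
import Data.Vec as Vec
import Data.Vec.Functional as VF
import Data.Vec.Properties as Vec
open import Defs
open import Function using (_∘_; id; case_of_)
open import Function.Bundles using (_⇔_; mk⇔; Equivalence)
open import Relation.Binary.Core using (_Preserves_⟶_)
open import Relation.Binary.Definitions using (DecidableEquality; tri<; tri≈; tri>)
open import Relation.Binary.PropositionalEquality
open import Relation.Nullary using (¬_; Dec; yes; no; does; ⌊_⌋)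
open import Relation.Nullary.Decidable using (dec-true; dec-false; does-⇔; isYes≗does; _×-dec_; toWitness; fromWitness)
open import Relation.Nullary.Negation using (contradiction)

open ≡-Reasoning

private
  variable
    A B : Set

-- Sums over lists

∑ : List A → (A → ℤ) → ℤ
∑ xs f = sumℤ (map f xs)

syntax ∑ xs (λ x → e) = ∑[ x ← xs ] e

𝟙 : Bool → ℤ
𝟙 true  = 1ℤ
𝟙 false = 0ℤ

∑-cong : ∀ xs {f g : A → ℤ} → (∀ x → f x ≡ g x) → ∑ xs f ≡ ∑ xs g
∑-cong []       f≗g = refl
∑-cong (x ∷ xs) f≗g = cong₂ _+_ (f≗g x) (∑-cong xs f≗g)

∑-zero : ∀ (xs : List A) → ∑[ x ← xs ] 0ℤ ≡ 0ℤ
∑-zero []       = refl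
∑-zero (x ∷ xs) = trans (+-identityˡ _) (∑-zero xs)

∑-+ : ∀ xs (f g : A → ℤ) → ∑[ x ← xs ] (f x + g x) ≡ ∑ xs f + ∑ xs g
∑-+ []       f g = refl
∑-+ (x ∷ xs) f g = trans (cong (_+_ (f x + g x)) (∑-+ xs f g)) (interchange +-commutativeSemigroup (f x) (g x) _ _)

∑-++ : ∀ xs ys (f : A → ℤ) → ∑ (xs ++ ys) f ≡ ∑ xs f + ∑ ys f
∑-++ []       ys f = sym (+-identityˡ _)
∑-++ (x ∷ xs) ys f = trans (cong (_+_ (f x)) (∑-++ xs ys f)) (sym (+-assoc (f x) _ _))

∑-*ˡ : ∀ (xs : List A) c (f : A → ℤ) → ∑[ x ← xs ] (c * f x) ≡ c * ∑ xs f
∑-*ˡ []       c f = sym (*-zeroʳ c)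
∑-*ˡ (x ∷ xs) c f = trans (cong (_+_ (c * f x)) (∑-*ˡ xs c f)) (sym (*-distribˡ-+ c (f x) _))

∑-*ʳ : ∀ (xs : List A) c (f : A → ℤ) → ∑[ x ← xs ] (f x * c) ≡ ∑ xs f * c
∑-*ʳ xs c f = trans (∑-cong xs (λ x → *-comm (f x) c)) (trans (∑-*ˡ xs c f) (*-comm c _))

∑-const : ∀ (xs : List A) c → ∑[ x ← xs ] c ≡ + length xs * c
∑-const []       c = refl
∑-const (x ∷ xs) c = begin
  c + ∑[ x ← xs ] c           ≡⟨ cong (_+_ c) (∑-const xs c) ⟩
  c + + length xs * c         ≡⟨ cong (_+ + length xs * c) (sym (*-identityˡ c)) ⟩
  1ℤ * c + + length xs * c    ≡⟨ sym (*-distribʳ-+ c 1ℤ (+ length xs)) ⟩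
  + suc (length xs) * c       ∎

∑-map : ∀ (g : A → B) xs (f : B → ℤ) → ∑ (map g xs) f ≡ ∑ xs (f ∘ g)
∑-map g []       f = refl
∑-map g (x ∷ xs) f = cong (_+_ (f (g x))) (∑-map g xs f)

∑-concatMap : ∀ (h : A → List B) xs (f : B → ℤ) → ∑ (concatMap h xs) f ≡ ∑[ x ← xs ] ∑ (h x) f
∑-concatMap h []       f = refl
∑-concatMap h (x ∷ xs) f = trans (∑-++ (h x) _ f) (cong (_+_ (∑ (h x) f)) (∑-concatMap h xs f))

∑-filterᵇ : ∀ (p : A → Bool) xs (f : A → ℤ) → ∑ (filterᵇ p xs) f ≡ ∑[ x ← xs ] (𝟙 (p x) * f x)
∑-filterᵇ p []       f = refl
∑-filterᵇ p (x ∷ xs) f with p x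
... | true  = cong₂ _+_ (sym (*-identityˡ (f x))) (∑-filterᵇ p xs f)
... | false = trans (∑-filterᵇ p xs f) (sym (+-identityˡ _))

∑-comm : ∀ (xs : List A) (ys : List B) (f : A → B → ℤ) →
         ∑[ x ← xs ] ∑[ y ← ys ] f x y ≡ ∑[ y ← ys ] ∑[ x ← xs ] f x y
∑-comm []       ys f = sym (∑-zero ys)
∑-comm (x ∷ xs) ys f = trans (cong (_+_ (∑ ys (f x))) (∑-comm xs ys f)) (sym (∑-+ ys (f x) _))

∑-mono-≤ : ∀ (xs : List A) {f g : A → ℤ} → (∀ x → f x ℤ.≤ g x) → ∑ xs f ℤ.≤ ∑ xs g
∑-mono-≤ []       f≤g = ≤-refl
∑-mono-≤ (x ∷ xs) f≤g = +-mono-≤ (f≤g x) (∑-mono-≤ xs f≤g)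

-- Defs decides with ⌊_⌋ = isYes, which unlike does only reduces on a literal yes/no.
⌊⌋-true : ∀ {P : Set} (P? : Dec P) → P → ⌊ P? ⌋ ≡ true
⌊⌋-true (yes _) _ = refl
⌊⌋-true (no ¬p) p = contradiction p ¬p

⌊⌋-false : ∀ {P : Set} (P? : Dec P) → ¬ P → ⌊ P? ⌋ ≡ false
⌊⌋-false (yes p) ¬p = contradiction p ¬p
⌊⌋-false (no _)  _  = refl

⌊⌋-⇔ : ∀ {P Q : Set} → P ⇔ Q → (P? : Dec P) (Q? : Dec Q) → ⌊ P? ⌋ ≡ ⌊ Q? ⌋
⌊⌋-⇔ P⇔Q P? Q? = trans (isYes≗does P?) (trans (does-⇔ P⇔Q P? Q?) (sym (isYes≗does Q?)))

⌊⌋-reflects : ∀ {P : Set} (P? : Dec P) {b} → P ⇔ (b ≡ true) → ⌊ P? ⌋ ≡ b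
⌊⌋-reflects P? {true}  P⇔b = ⌊⌋-true P? (Equivalence.from P⇔b refl)
⌊⌋-reflects P? {false} P⇔b = ⌊⌋-false P? (λ p → contradiction (Equivalence.to P⇔b p) λ ())

𝟙-∧ : ∀ a b → 𝟙 (a ∧ b) ≡ 𝟙 a * 𝟙 b
𝟙-∧ true  b = sym (*-identityˡ (𝟙 b))
𝟙-∧ false b = refl

𝟙*-cong : ∀ {P : Set} (P? : Dec P) {x y} → (P → x ≡ y) → 𝟙 (does P?) * x ≡ 𝟙 (does P?) * y
𝟙*-cong (yes p) x≡y = cong (1ℤ *_) (x≡y p)
𝟙*-cong (no  _) x≡y = refl

𝟙*𝟙*-cong : ∀ {P : Set} (P? : Dec P) b {x y} → (P → b ≡ true → x ≡ y) →
            𝟙 (does P?) * (𝟙 b * x) ≡ (𝟙 (does P?) * 𝟙 b) * y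
𝟙*𝟙*-cong (yes p) true  {x} {y} x≡y =
  trans (*-identityˡ (1ℤ * x)) (trans (*-identityˡ x) (trans (x≡y p refl) (sym (*-identityˡ y))))
𝟙*𝟙*-cong (yes p) false x≡y = refl
𝟙*𝟙*-cong (no _)  b     x≡y = refl

𝟙*-nonneg : ∀ b {x} → 0ℤ ℤ.≤ x → 0ℤ ℤ.≤ 𝟙 b * x
𝟙*-nonneg true  {x} 0≤x = ≤-trans 0≤x (≤-reflexive (sym (*-identityˡ x)))
𝟙*-nonneg false     _   = ≤-refl

𝟙*-≤ : ∀ b {x} → 0ℤ ℤ.≤ x → 𝟙 b * x ℤ.≤ x
𝟙*-≤ true  {x} _   = ≤-reflexive (*-identityˡ x)
𝟙*-≤ false     0≤x = 0≤x

-- Counting functions Fin n → A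

module _ {A : Set} (_≟ᴬ_ : DecidableEquality A) where

  infix 4 _≗?_
  _≗?_ : ∀ {n} (f g : Fin n → A) → Dec (f ≗ g)
  f ≗? g = Fin.all? (λ j → f j ≟ᴬ g j)

  ≗?-sym : ∀ {n} (f g : Fin n → A) → does (f ≗? g) ≡ does (g ≗? f)
  ≗?-sym f g = does-⇔ (mk⇔ (λ f≗g → sym ∘ f≗g) (λ g≗f → sym ∘ g≗f)) (f ≗? g) (g ≗? f)

  ≗?-∷ : ∀ {n} x (f : Fin n → A) g → does (x VF.∷ f ≗? g) ≡ does (x ≟ᴬ g zero) ∧ does (f ≗? g ∘ suc)
  ≗?-∷ x f g = does-⇔ (mk⇔ (λ h → h zero , h ∘ suc) (λ { (h₀ , h) zero → h₀ ; (h₀ , h) (suc j) → h j }))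
                      (x VF.∷ f ≗? g) (x ≟ᴬ g zero ×-dec f ≗? g ∘ suc)

  module Enumeration (xs : List A) (xs-once : ∀ b → ∑[ a ← xs ] 𝟙 (does (a ≟ᴬ b)) ≡ 1ℤ) where

    ∑-allFuns-suc : ∀ {n} (H : (Fin (suc n) → A) → ℤ) →
                    ∑ (allFuns (suc n) xs) H ≡ ∑[ x ← xs ] ∑[ f ← allFuns n xs ] H (x VF.∷ f)
    ∑-allFuns-suc {n} H = trans (∑-concatMap _ xs H) (∑-cong xs (λ x → ∑-map (x VF.∷_) (allFuns n xs) H))

    allFuns-once : ∀ n (g : Fin n → A) → ∑[ f ← allFuns n xs ] 𝟙 (does (f ≗? g)) ≡ 1ℤ
    allFuns-once zero    g = cong (λ b → 𝟙 b + 0ℤ) (dec-true ((λ ()) ≗? g) (λ ()))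
    allFuns-once (suc n) g = begin
      ∑[ f ← allFuns (suc n) xs ] 𝟙 (does (f ≗? g))
        ≡⟨ ∑-allFuns-suc _ ⟩
      ∑[ x ← xs ] ∑[ f ← allFuns n xs ] 𝟙 (does (x VF.∷ f ≗? g))
        ≡⟨ ∑-cong xs (λ x → ∑-cong (allFuns n xs) (λ f →
             trans (cong 𝟙 (≗?-∷ x f g)) (𝟙-∧ (does (x ≟ᴬ g zero)) (does (f ≗? g ∘ suc))))) ⟩
      ∑[ x ← xs ] ∑[ f ← allFuns n xs ] (𝟙 (does (x ≟ᴬ g zero)) * 𝟙 (does (f ≗? g ∘ suc)))
        ≡⟨ ∑-cong xs (λ x → ∑-*ˡ (allFuns n xs) (𝟙 (does (x ≟ᴬ g zero))) (λ f → 𝟙 (does (f ≗? g ∘ suc)))) ⟩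
      ∑[ x ← xs ] (𝟙 (does (x ≟ᴬ g zero)) * ∑[ f ← allFuns n xs ] 𝟙 (does (f ≗? g ∘ suc)))
        ≡⟨ ∑-cong xs (λ x → trans (cong (𝟙 (does (x ≟ᴬ g zero)) *_) (allFuns-once n (g ∘ suc)))
                                  (*-identityʳ (𝟙 (does (x ≟ᴬ g zero))))) ⟩
      ∑[ x ← xs ] 𝟙 (does (x ≟ᴬ g zero))
        ≡⟨ xs-once (g zero) ⟩
      1ℤ ∎

    ∑-sift : ∀ {n} (H : (Fin n → A) → ℤ) → H Preserves _≗_ ⟶ _≡_ →
             ∀ g → ∑[ f ← allFuns n xs ] (𝟙 (does (f ≗? g)) * H f) ≡ H g
    ∑-sift {n} H H-cong g = begin
      ∑[ f ← allFuns n xs ] (𝟙 (does (f ≗? g)) * H f)  ≡⟨ ∑-cong (allFuns n xs) (λ f → 𝟙*-cong (f ≗? g) H-cong) ⟩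
      ∑[ f ← allFuns n xs ] (𝟙 (does (f ≗? g)) * H g)  ≡⟨ ∑-*ʳ (allFuns n xs) (H g) (λ f → 𝟙 (does (f ≗? g))) ⟩
      ∑[ f ← allFuns n xs ] 𝟙 (does (f ≗? g)) * H g    ≡⟨ cong (_* H g) (allFuns-once n g) ⟩
      1ℤ * H g                                         ≡⟨ *-identityˡ (H g) ⟩
      H g                                              ∎

    -- The sifted sum at g lies between 0 and the full sum.
    allFuns-nonneg-zero : ∀ {n} (H : (Fin n → A) → ℤ) → H Preserves _≗_ ⟶ _≡_ → (∀ f → 0ℤ ℤ.≤ H f) →
                          ∑ (allFuns n xs) H ≡ 0ℤ → ∀ g → H g ≡ 0ℤ
    allFuns-nonneg-zero {n} H H-cong H≥0 ∑H≡0 g = trans (sym (∑-sift H H-cong g)) (≤-antisym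
      (≤-trans (∑-mono-≤ (allFuns n xs) (λ f → 𝟙*-≤ (does (f ≗? g)) (H≥0 f))) (≤-reflexive ∑H≡0))
      (≤-trans (≤-reflexive (sym (∑-zero (allFuns n xs))))
               (∑-mono-≤ (allFuns n xs) (λ f → 𝟙*-nonneg (does (f ≗? g)) (H≥0 f)))))

    ∑-fibres : ∀ {X : Set} {n} (L : List X) (φ : X → Fin n → A) (G : X → ℤ) →
               ∑ L G ≡ ∑[ y ← allFuns n xs ] ∑[ x ← L ] (𝟙 (does (φ x ≗? y)) * G x)
    ∑-fibres {n = n} L φ G = begin
      ∑ L G
        ≡⟨ ∑-cong L (λ x → sym (trans (cong (_* G x) (once x)) (*-identityˡ (G x)))) ⟩
      ∑[ x ← L ] (∑[ y ← allFuns n xs ] 𝟙 (does (φ x ≗? y)) * G x)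
        ≡⟨ ∑-cong L (λ x → sym (∑-*ʳ (allFuns n xs) (G x) (λ y → 𝟙 (does (φ x ≗? y))))) ⟩
      ∑[ x ← L ] ∑[ y ← allFuns n xs ] (𝟙 (does (φ x ≗? y)) * G x)
        ≡⟨ ∑-comm L (allFuns n xs) (λ x y → 𝟙 (does (φ x ≗? y)) * G x) ⟩
      ∑[ y ← allFuns n xs ] ∑[ x ← L ] (𝟙 (does (φ x ≗? y)) * G x) ∎
      where
      once : ∀ x → ∑[ y ← allFuns n xs ] 𝟙 (does (φ x ≗? y)) ≡ 1ℤ
      once x = trans (∑-cong (allFuns n xs) (λ y → cong 𝟙 (≗?-sym (φ x) y))) (allFuns-once n (φ x))

∑-allFin-suc : ∀ {k} (f : Fin (suc k) → ℤ) → ∑ (allFin (suc k)) f ≡ f zero + ∑[ a ← allFin k ] f (suc a)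
∑-allFin-suc {k} f =
  cong (_+_ (f zero)) (trans (cong (λ as → ∑ as f) (sym (map-tabulate id suc))) (∑-map suc (allFin k) f))

allFin-once : ∀ {k} (b : Fin k) → ∑[ a ← allFin k ] 𝟙 (does (a Fin.≟ b)) ≡ 1ℤ
allFin-once {suc k} zero    =
  trans (∑-allFin-suc {k} (λ a → 𝟙 (does (a Fin.≟ zero)))) (cong (_+_ 1ℤ) (∑-zero {A = Fin k} (allFin k)))
allFin-once {suc k} (suc b) =
  trans (∑-allFin-suc {k} (λ a → 𝟙 (does (a Fin.≟ suc b)))) (trans (+-identityˡ _) (allFin-once b))

infix 4 _≟ₘ_
_≟ₘ_ : ∀ {k} → DecidableEquality (Maybe (Fin k))
_≟ₘ_ = Maybe.≡-dec Fin._≟_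

allMaybe-once : ∀ {k} (b : Maybe (Fin k)) → ∑[ a ← allMaybe k ] 𝟙 (does (a ≟ₘ b)) ≡ 1ℤ
allMaybe-once {k} nothing  = cong (_+_ 1ℤ) (trans (∑-map just (allFin k) _) (∑-zero (allFin k)))
allMaybe-once {k} (just b) = trans (+-identityˡ _) (trans (∑-map just (allFin k) _) (allFin-once b))

infix 4 _≗ᶠ?_ _≗ʳ?_
_≗ᶠ?_ : ∀ {n k} (f g : Fin n → Fin k) → Dec (f ≗ g)
_≗ᶠ?_ = _≗?_ Fin._≟_

_≗ʳ?_ : ∀ {n k} (r r′ : Fin n → Maybe (Fin k)) → Dec (r ≗ r′)
_≗ʳ?_ = _≗?_ _≟ₘ_

module FinFuns (k : ℕ) = Enumeration Fin._≟_ (allFin k) allFin-once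
module RankingFuns (k : ℕ) = Enumeration _≟ₘ_ (allMaybe k) allMaybe-once

-- Partial rankings with a prescribed support

T-all-allFin : ∀ {n} (p : Fin n → Bool) → T (all p (allFin n)) ⇔ (∀ j → T (p j))
T-all-allFin p = mk⇔ (All.tabulate⁻ ∘ All.all⁺ p _) (All.all⁻ p ∘ All.tabulate⁺)

all-allFin-cong : ∀ {n} {p q : Fin n → Bool} → p ≗ q → all p (allFin n) ≡ all q (allFin n)
all-allFin-cong {n} p≗q = cong and (map-cong p≗q (allFin n))

-- isBijOn with the support given by a predicate: isBijOn I is isBijOn′ (lookup I).
isBijOn′ : ∀ {n k} → (Fin n → Bool) → (Fin n → Maybe (Fin k)) → Bool
isBijOn′ {n} P r =
     all (λ j → if P j then isJust (r j) else not (isJust (r j))) (allFin n)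
  ∧ all (λ a → all (λ b → if maybeEq (r a) (r b) then ⌊ a Fin.≟ b ⌋ else true) (allFin n)) (allFin n)

record IsBijOn {n k} (P : Fin n → Bool) (r : Fin n → Maybe (Fin k)) : Set where
  field
    defined   : ∀ {j} → P j ≡ true → ∃ λ a → r j ≡ just a
    undefined : ∀ {j} → P j ≡ false → r j ≡ nothing
    injective : ∀ {a b x} → r a ≡ just x → r b ≡ just x → a ≡ b

module _ {n k : ℕ} where

  private
    SupportTest : Bool → Maybe (Fin k) → Set
    SupportTest p x = T (if p then isJust x else not (isJust x))

    InjectivityTest : Fin n → Fin n → Maybe (Fin k) → Maybe (Fin k) → Set
    InjectivityTest a b u v = T (if maybeEq u v then ⌊ a Fin.≟ b ⌋ else true)

    support-defined : ∀ {p} x → SupportTest p x → p ≡ true → ∃ λ a → x ≡ just a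
    support-defined (just a) _ refl = a , refl

    support-undefined : ∀ {p} x → SupportTest p x → p ≡ false → x ≡ nothing
    support-undefined nothing _ refl = refl

    support-test : ∀ {p} x → (p ≡ true → ∃ λ a → x ≡ just a) → (p ≡ false → x ≡ nothing) → SupportTest p x
    support-test {true}  x def _ with def refl
    ... | a , refl = _
    support-test {false} x _ undef rewrite undef refl = _

    injectivity-sound : ∀ {a b x} u v → u ≡ just x → v ≡ just x → InjectivityTest a b u v → a ≡ b
    injectivity-sound {a} {b} {x} _ _ refl refl t with x Fin.≟ x
    ... | yes _   = toWitness {a? = a Fin.≟ b} t
    ... | no x≢x = contradiction refl x≢x

    injectivity-test : ∀ a b u v → (∀ {x} → u ≡ just x → v ≡ just x → a ≡ b) → InjectivityTest a b u v
    injectivity-test a b (just x) (just y) inj with x Fin.≟ y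
    ... | yes refl = fromWitness (inj refl refl)
    ... | no  _    = _
    injectivity-test a b (just x) nothing  inj = _
    injectivity-test a b nothing  v        inj = _

  module _ {P : Fin n → Bool} {r : Fin n → Maybe (Fin k)} where

    isBijOn′-sound : isBijOn′ P r ≡ true → IsBijOn P r
    isBijOn′-sound bij = record
      { defined   = λ {j} → support-defined (r j) (supports j)
      ; undefined = λ {j} → support-undefined (r j) (supports j)
      ; injective = λ {a} {b} ra rb → injectivity-sound (r a) (r b) ra rb (injectivities a b)
      }
      where
      tests : T (all _ (allFin n)) × T (all _ (allFin n))
      tests = Equivalence.to T-∧ (Equivalence.from T-≡ bij)
      supports : ∀ j → SupportTest (P j) (r j)
      supports = Equivalence.to (T-all-allFin _) (proj₁ tests)
      injectivities : ∀ a b → InjectivityTest a b (r a) (r b)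
      injectivities a = Equivalence.to (T-all-allFin _) (Equivalence.to (T-all-allFin _) (proj₂ tests) a)

    isBijOn′-complete : IsBijOn P r → isBijOn′ P r ≡ true
    isBijOn′-complete bij = Equivalence.to T-≡ (Equivalence.from T-∧
      ( Equivalence.from (T-all-allFin _) (λ j → support-test (r j) defined undefined)
      , Equivalence.from (T-all-allFin _) (λ a → Equivalence.from (T-all-allFin _) (λ b →
          injectivity-test a b (r a) (r b) injective))))
      where open IsBijOn bij

    isBijOn′-false : isBijOn′ P r ≡ false → ¬ IsBijOn P r
    isBijOn′-false ¬bij bij with () ← trans (sym ¬bij) (isBijOn′-complete bij)

  isBijOn′-cong : ∀ {P P′ : Fin n → Bool} {r r′ : Fin n → Maybe (Fin k)} → P ≗ P′ → r ≗ r′ →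
                  isBijOn′ P r ≡ isBijOn′ P′ r′
  isBijOn′-cong P≗P′ r≗r′ = cong₂ _∧_
    (all-allFin-cong (λ j → cong₂ (λ p x → if p then isJust x else not (isJust x)) (P≗P′ j) (r≗r′ j)))
    (all-allFin-cong (λ a → all-allFin-cong (λ b →
      cong₂ (λ u v → if maybeEq u v then ⌊ a Fin.≟ b ⌋ else true) (r≗r′ a) (r≗r′ b))))

  IsBijOn-resp : ∀ {P} {r r′ : Fin n → Maybe (Fin k)} → r ≗ r′ → IsBijOn P r → IsBijOn P r′
  IsBijOn-resp r≗r′ bij = record
    { defined   = λ Pj → let a , ra = defined Pj in a , trans (sym (r≗r′ _)) ra
    ; undefined = λ Pj → trans (sym (r≗r′ _)) (undefined Pj)
    ; injective = λ ra rb → injective (trans (r≗r′ _) ra) (trans (r≗r′ _) rb)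
    }
    where open IsBijOn bij

isInjective-cong : ∀ {n k} {f g : Fin n → Fin k} → f ≗ g → isInjective f ≡ isInjective g
isInjective-cong f≗g = all-allFin-cong (λ a → all-allFin-cong (λ b →
  cong₂ (λ x y → if ⌊ x Fin.≟ y ⌋ then ⌊ a Fin.≟ b ⌋ else true) (f≗g a) (f≗g b)))

isInjective-complete : ∀ {n k} {f : Fin n → Fin k} → (∀ {a b} → f a ≡ f b → a ≡ b) → isInjective f ≡ true
isInjective-complete {f = f} f-injective = Equivalence.to T-≡
  (Equivalence.from (T-all-allFin _) λ a → Equivalence.from (T-all-allFin _) λ b → test a b)
  where
  test : ∀ a b → T (if ⌊ f a Fin.≟ f b ⌋ then ⌊ a Fin.≟ b ⌋ else true)
  test a b with f a Fin.≟ f b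
  ... | yes e = fromWitness (f-injective e)
  ... | no  _ = _

isBijOn′-full : ∀ {n} {P : Fin n → Bool} → (∀ j → P j ≡ true) → (π : Fin n → Fin n) →
                isBijOn′ P (just ∘ π) ≡ isInjective π
isBijOn′-full {n} {P} full π = cong (_∧ isInjective π) (Equivalence.to T-≡ (Equivalence.from (T-all-allFin _) defined))
  where
  defined : ∀ j → T (if P j then true else false)
  defined j rewrite full j = _

total-or-partial : ∀ {n k} (r : Fin n → Maybe (Fin k)) → (∃ λ π → r ≗ just ∘ π) ⊎ (∃ λ j → r j ≡ nothing)
total-or-partial {zero}  r = inj₁ ((λ ()) , λ ())
total-or-partial {suc n} r with r zero in r0 | total-or-partial (r ∘ suc)
... | nothing | _             = inj₂ (zero , r0)
... | just a  | inj₂ (j , rj) = inj₂ (suc j , rj)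
... | just a  | inj₁ (π , r≗) = inj₁ (a VF.∷ π , λ { zero → r0 ; (suc j) → r≗ j })

∑-Perms : ∀ {n} {P : Fin n → Bool} → (∀ j → P j ≡ true) →
          (H : (Fin n → Maybe (Fin n)) → ℤ) → H Preserves _≗_ ⟶ _≡_ →
          ∑[ π ← Perms n ] H (just ∘ π) ≡ ∑[ r ← allFuns n (allMaybe n) ] (𝟙 (isBijOn′ P r) * H r)
∑-Perms {n} {P} full H H-cong = begin
  ∑[ π ← Perms n ] H (just ∘ π)
    ≡⟨ ∑-filterᵇ isInjective Fs (H ∘ (just ∘_)) ⟩
  ∑[ π ← Fs ] F π
    ≡⟨ RankingFuns.∑-fibres n Fs (just ∘_) F ⟩
  ∑[ r ← allFuns n (allMaybe n) ] ∑[ π ← Fs ] (𝟙 (does (just ∘ π ≗ʳ? r)) * F π)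
    ≡⟨ ∑-cong (allFuns n (allMaybe n)) (λ r → fibre r (total-or-partial r)) ⟩
  ∑[ r ← allFuns n (allMaybe n) ] (𝟙 (isBijOn′ P r) * H r) ∎
  where
  Fs : List (Fin n → Fin n)
  Fs = allFuns n (allFin n)

  F : (Fin n → Fin n) → ℤ
  F π = 𝟙 (isInjective π) * H (just ∘ π)

  F-cong : F Preserves _≗_ ⟶ _≡_
  F-cong π≗π′ = cong₂ (λ b h → 𝟙 b * h) (isInjective-cong π≗π′) (H-cong (cong just ∘ π≗π′))

  fibre : ∀ r → (∃ λ π → r ≗ just ∘ π) ⊎ (∃ λ j → r j ≡ nothing) →
          ∑[ π ← Fs ] (𝟙 (does (just ∘ π ≗ʳ? r)) * F π) ≡ 𝟙 (isBijOn′ P r) * H r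
  fibre r (inj₁ (π₀ , r≗)) = begin
    ∑[ π ← Fs ] (𝟙 (does (just ∘ π ≗ʳ? r)) * F π)
      ≡⟨ ∑-cong Fs (λ π → cong (λ b → 𝟙 b * F π)
                    (does-⇔ (just∘π≗r⇔ π) (just ∘ π ≗ʳ? r) (π ≗ᶠ? π₀))) ⟩
    ∑[ π ← Fs ] (𝟙 (does (π ≗ᶠ? π₀)) * F π)
      ≡⟨ FinFuns.∑-sift n F F-cong π₀ ⟩
    𝟙 (isInjective π₀) * H (just ∘ π₀)
      ≡⟨ cong₂ (λ b h → 𝟙 b * h) (trans (sym (isBijOn′-full full π₀)) (isBijOn′-cong (λ _ → refl) (sym ∘ r≗)))
                                 (H-cong (sym ∘ r≗)) ⟩
    𝟙 (isBijOn′ P r) * H r ∎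
    where
    just∘π≗r⇔ : ∀ π → (just ∘ π ≗ r) ⇔ (π ≗ π₀)
    just∘π≗r⇔ π = mk⇔ (λ eq j → just-injective (trans (eq j) (r≗ j))) (λ eq j → trans (cong just (eq j)) (sym (r≗ j)))
  fibre r (inj₂ (j , rj)) = begin
    ∑[ π ← Fs ] (𝟙 (does (just ∘ π ≗ʳ? r)) * F π)
      ≡⟨ ∑-cong Fs (λ π → cong (λ b → 𝟙 b * F π) (never π)) ⟩
    ∑[ π ← Fs ] 0ℤ
      ≡⟨ ∑-zero Fs ⟩
    0ℤ
      ≡⟨ cong (λ b → 𝟙 b * H r) (sym not-bij) ⟩
    𝟙 (isBijOn′ P r) * H r ∎
    where
    never : ∀ π → does (just ∘ π ≗ʳ? r) ≡ false
    never π = dec-false (just ∘ π ≗ʳ? r) (λ eq → contradiction (trans (eq j) rj) λ ())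
    not-bij : isBijOn′ P r ≡ false
    not-bij with isBijOn′ P r in bij
    ... | true  = contradiction (trans (sym (proj₂ (IsBijOn.defined (isBijOn′-sound {P = P} {r} bij) (full j)))) rj) λ ()
    ... | false = refl

-- Deleting an element from a ranking and inserting it back

-- squeeze (just b) deletes the rank b from Fin (suc k) and closes the gap.
squeeze : ∀ {k} → Maybe (Fin (suc k)) → Maybe (Fin (suc k)) → Maybe (Fin k)
squeeze (just b) (just a) with b Fin.≟ a
... | yes _   = nothing
... | no b≢a = just (Fin.punchOut b≢a)
squeeze _ _ = nothing

module _ {k : ℕ} {b : Fin (suc k)} where

  squeeze-just : ∀ {a} (b≢a : b ≢ a) → squeeze (just b) (just a) ≡ just (Fin.punchOut b≢a)
  squeeze-just {a} b≢a with b Fin.≟ a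
  ... | yes b≡a = contradiction b≡a b≢a
  ... | no  _   = cong just (Fin.punchOut-cong b refl)

  squeeze-just⁻ : ∀ {x y} → squeeze (just b) x ≡ just y → x ≡ just (Fin.punchIn b y)
  squeeze-just⁻ {just a} eq with b Fin.≟ a
  ... | no b≢a = cong just (trans (sym (Fin.punchIn-punchOut b≢a)) (cong (Fin.punchIn b) (just-injective eq)))

  squeeze-map-punchIn : ∀ x → squeeze (just b) (Maybe.map (Fin.punchIn b) x) ≡ x
  squeeze-map-punchIn nothing  = refl
  squeeze-map-punchIn (just a) =
    trans (squeeze-just (Fin.punchInᵢ≢i b a ∘ sym)) (cong just (Fin.punchOut-punchIn b))

  map-punchIn-squeeze : ∀ x → x ≢ just b → Maybe.map (Fin.punchIn b) (squeeze (just b) x) ≡ x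
  map-punchIn-squeeze nothing  _   = refl
  map-punchIn-squeeze (just a) a≢b =
    trans (cong (Maybe.map (Fin.punchIn b)) (squeeze-just b≢a)) (cong just (Fin.punchIn-punchOut b≢a))
    where
    b≢a : b ≢ a
    b≢a b≡a = a≢b (cong just (sym b≡a))

  map-punchIn≢just : ∀ x → Maybe.map (Fin.punchIn b) x ≢ just b
  map-punchIn≢just (just a) eq = Fin.punchInᵢ≢i b a (just-injective eq)

  squeeze-geq : ∀ x y → x ≢ just b → y ≢ just b → geq (squeeze (just b) x) (squeeze (just b) y) ≡ geq x y
  squeeze-geq nothing  y        _   _   = refl
  squeeze-geq (just a) nothing  a≢b _   rewrite squeeze-just (a≢b ∘ cong just ∘ sym) = refl
  squeeze-geq (just a) (just c) a≢b c≢b = begin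
    geq (squeeze (just b) (just a)) (squeeze (just b) (just c))  ≡⟨ cong₂ geq (squeeze-just b≢a) (squeeze-just b≢c) ⟩
    ⌊ Fin.punchOut b≢c Fin.≤? Fin.punchOut b≢a ⌋                ≡⟨ ⌊⌋-⇔ punchOut-≤⇔ _ _ ⟩
    ⌊ c Fin.≤? a ⌋                                               ∎
    where
    b≢a : b ≢ a
    b≢a = a≢b ∘ cong just ∘ sym
    b≢c : b ≢ c
    b≢c = c≢b ∘ cong just ∘ sym
    punchOut-≤⇔ : Fin.punchOut b≢c Fin.≤ Fin.punchOut b≢a ⇔ c Fin.≤ a
    punchOut-≤⇔ = mk⇔ (Fin.punchOut-cancel-≤ b≢c b≢a) (Fin.punchOut-mono-≤ b≢c b≢a)

module _ {n : ℕ} (d : Fin n) where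

  deleteAt : ∀ {k} → (Fin n → Maybe (Fin (suc k))) → Fin n → Maybe (Fin k)
  deleteAt r j with j Fin.≟ d
  ... | yes _ = nothing
  ... | no  _ = squeeze (r d) (r j)

  insertAt : ∀ {k} → Fin (suc k) → (Fin n → Maybe (Fin k)) → Fin n → Maybe (Fin (suc k))
  insertAt p r j with j Fin.≟ d
  ... | yes _ = just p
  ... | no  _ = Maybe.map (Fin.punchIn p) (r j)

  module _ {k : ℕ} where

    deleteAt-self : ∀ (r : Fin n → Maybe (Fin (suc k))) → deleteAt r d ≡ nothing
    deleteAt-self r with d Fin.≟ d
    ... | yes _   = refl
    ... | no d≢d = contradiction refl d≢d

    deleteAt-other : ∀ (r : Fin n → Maybe (Fin (suc k))) {j} → j ≢ d → deleteAt r j ≡ squeeze (r d) (r j)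
    deleteAt-other r {j} j≢d with j Fin.≟ d
    ... | yes j≡d = contradiction j≡d j≢d
    ... | no  _   = refl

    insertAt-self : ∀ p (r : Fin n → Maybe (Fin k)) → insertAt p r d ≡ just p
    insertAt-self p r with d Fin.≟ d
    ... | yes _   = refl
    ... | no d≢d = contradiction refl d≢d

    insertAt-other : ∀ p (r : Fin n → Maybe (Fin k)) {j} → j ≢ d → insertAt p r j ≡ Maybe.map (Fin.punchIn p) (r j)
    insertAt-other p r {j} j≢d with j Fin.≟ d
    ... | yes j≡d = contradiction j≡d j≢d
    ... | no  _   = refl

    deleteAt-cong : ∀ {r r′ : Fin n → Maybe (Fin (suc k))} → r ≗ r′ → deleteAt r ≗ deleteAt r′
    deleteAt-cong r≗r′ j with j Fin.≟ d
    ... | yes _ = refl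
    ... | no  _ = cong₂ squeeze (r≗r′ d) (r≗r′ j)

    insertAt-cong : ∀ p {r r′ : Fin n → Maybe (Fin k)} → r ≗ r′ → insertAt p r ≗ insertAt p r′
    insertAt-cong p r≗r′ j with j Fin.≟ d
    ... | yes _ = refl
    ... | no  _ = cong (Maybe.map (Fin.punchIn p)) (r≗r′ j)

    deleteAt-insertAt : ∀ p (r : Fin n → Maybe (Fin k)) → r d ≡ nothing → deleteAt (insertAt p r) ≗ r
    deleteAt-insertAt p r rd j = case j Fin.≟ d of λ where
      (yes refl) → trans (deleteAt-self (insertAt p r)) (sym rd)
      (no j≢d)   → begin
        deleteAt (insertAt p r) j                          ≡⟨ deleteAt-other (insertAt p r) j≢d ⟩
        squeeze (insertAt p r d) (insertAt p r j)          ≡⟨ cong₂ squeeze (insertAt-self p r) (insertAt-other p r j≢d) ⟩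
        squeeze (just p) (Maybe.map (Fin.punchIn p) (r j)) ≡⟨ squeeze-map-punchIn (r j) ⟩
        r j                                                ∎

  module _ {P P′ : Fin n → Bool} (d∈P : P d ≡ true) (d∉P′ : P′ d ≡ false)
           (P≗P′ : ∀ {j} → j ≢ d → P j ≡ P′ j) {k : ℕ} where

    module _ {r : Fin n → Maybe (Fin (suc k))} (bij : IsBijOn P r) {b} (rd : r d ≡ just b) where
      open IsBijOn bij

      private
        r≢b : ∀ {j} → j ≢ d → r j ≢ just b
        r≢b j≢d rj = j≢d (injective rj rd)

        deleteAt-other′ : ∀ {j} → j ≢ d → deleteAt r j ≡ squeeze (just b) (r j)
        deleteAt-other′ {j} j≢d = trans (deleteAt-other r j≢d) (cong (λ u → squeeze u (r j)) rd)

        deleteAt-just⁻ : ∀ {j x} → deleteAt r j ≡ just x → r j ≡ just (Fin.punchIn b x)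
        deleteAt-just⁻ {j} eq = case j Fin.≟ d of λ where
          (yes refl) → contradiction (trans (sym (deleteAt-self r)) eq) λ ()
          (no j≢d)   → squeeze-just⁻ (trans (sym (deleteAt-other′ j≢d)) eq)

      deleteAt-bij : IsBijOn P′ (deleteAt r)
      deleteAt-bij = record { defined = defined′ ; undefined = undefined′ ; injective = injective′ }
        where
        defined′ : ∀ {j} → P′ j ≡ true → ∃ λ a → deleteAt r j ≡ just a
        defined′ {j} P′j = case j Fin.≟ d of λ where
          (yes refl) → contradiction (trans (sym d∉P′) P′j) λ ()
          (no j≢d)   → let a , ra = defined (trans (P≗P′ j≢d) P′j) in
            _ , trans (deleteAt-other′ j≢d)
                      (trans (cong (squeeze (just b)) ra) (squeeze-just (r≢b j≢d ∘ trans ra ∘ cong just ∘ sym)))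
        undefined′ : ∀ {j} → P′ j ≡ false → deleteAt r j ≡ nothing
        undefined′ {j} ¬P′j = case j Fin.≟ d of λ where
          (yes refl) → deleteAt-self r
          (no j≢d)   → trans (deleteAt-other′ j≢d) (cong (squeeze (just b)) (undefined (trans (P≗P′ j≢d) ¬P′j)))
        injective′ : ∀ {a c x} → deleteAt r a ≡ just x → deleteAt r c ≡ just x → a ≡ c
        injective′ ra rc = injective (deleteAt-just⁻ ra) (deleteAt-just⁻ rc)

      insertAt-deleteAt : insertAt b (deleteAt r) ≗ r
      insertAt-deleteAt j = case j Fin.≟ d of λ where
        (yes refl) → trans (insertAt-self b (deleteAt r)) (sym rd)
        (no j≢d)   → begin
          insertAt b (deleteAt r) j                          ≡⟨ insertAt-other b (deleteAt r) j≢d ⟩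
          Maybe.map (Fin.punchIn b) (deleteAt r j)           ≡⟨ cong (Maybe.map (Fin.punchIn b)) (deleteAt-other′ j≢d) ⟩
          Maybe.map (Fin.punchIn b) (squeeze (just b) (r j)) ≡⟨ map-punchIn-squeeze (r j) (r≢b j≢d) ⟩
          r j                                                ∎

      ≗insertAt⇔ : ∀ {r′} p → deleteAt r ≗ r′ → (r ≗ insertAt p r′ ⇔ p ≡ b)
      ≗insertAt⇔ {r′} p del≗r′ = mk⇔
        (λ r≗ → just-injective (trans (sym (insertAt-self p r′)) (trans (sym (r≗ d)) rd)))
        (λ { refl j → sym (trans (insertAt-cong b (sym ∘ del≗r′) j) (insertAt-deleteAt j)) })

    insertAt-bij : ∀ {r′ : Fin n → Maybe (Fin k)} p → IsBijOn P′ r′ → IsBijOn P (insertAt p r′)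
    insertAt-bij {r′} p bij = record { defined = defined′ ; undefined = undefined′ ; injective = injective′ }
      where
      open IsBijOn bij
      defined′ : ∀ {j} → P j ≡ true → ∃ λ a → insertAt p r′ j ≡ just a
      defined′ {j} Pj = case j Fin.≟ d of λ where
        (yes refl) → p , insertAt-self p r′
        (no j≢d)   → let a , ra = defined (trans (sym (P≗P′ j≢d)) Pj) in
          Fin.punchIn p a , trans (insertAt-other p r′ j≢d) (Maybe.map-just ra)
      undefined′ : ∀ {j} → P j ≡ false → insertAt p r′ j ≡ nothing
      undefined′ {j} ¬Pj = case j Fin.≟ d of λ where
        (yes refl) → contradiction (trans (sym d∈P) ¬Pj) λ ()
        (no j≢d)   → trans (insertAt-other p r′ j≢d) (Maybe.map-nothing (undefined (trans (sym (P≗P′ j≢d)) ¬Pj)))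
      map-just⁻ : ∀ {u : Maybe (Fin k)} {x} → Maybe.map (Fin.punchIn p) u ≡ just x → ∃ λ y → u ≡ just y
      map-just⁻ {just y} _ = y , refl
      off-d : ∀ {c x} → c ≢ d → insertAt p r′ c ≡ just x → Maybe.map (Fin.punchIn p) (r′ c) ≡ just x
      off-d c≢d = trans (sym (insertAt-other p r′ c≢d))
      on-d : ∀ {x} → insertAt p r′ d ≡ just x → just x ≡ just p
      on-d rd = trans (sym rd) (insertAt-self p r′)
      injective′ : ∀ {a c x} → insertAt p r′ a ≡ just x → insertAt p r′ c ≡ just x → a ≡ c
      injective′ {a} {c} ra rc = case ((a Fin.≟ d) , (c Fin.≟ d)) of λ where
        (yes refl , yes refl) → refl
        (yes refl , no c≢d)   → contradiction (trans (off-d c≢d rc) (on-d ra)) (map-punchIn≢just (r′ c))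
        (no a≢d   , yes refl) → contradiction (trans (off-d a≢d ra) (on-d rc)) (map-punchIn≢just (r′ a))
        (no a≢d   , no c≢d)   →
          let y , r′a = map-just⁻ (off-d a≢d ra)
              r′a≡r′c = Maybe.map-injective (Fin.punchIn-injective p _ _) (trans (off-d a≢d ra) (sym (off-d c≢d rc)))
          in injective r′a (trans (sym r′a≡r′c) r′a)

    insertAt-fibre : ∀ {r′ : Fin n → Maybe (Fin k)} {r} p → IsBijOn P′ r′ → r ≗ insertAt p r′ →
                     IsBijOn P r × deleteAt r ≗ r′
    insertAt-fibre {r′} p bij r≗ =
        IsBijOn-resp (sym ∘ r≗) (insertAt-bij p bij)
      , λ j → trans (deleteAt-cong r≗ j) (deleteAt-insertAt p r′ (IsBijOn.undefined bij d∉P′) j)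

    fibre-size : ∀ (r : Fin n → Maybe (Fin (suc k))) r′ →
                 𝟙 (does (deleteAt r ≗ʳ? r′)) * 𝟙 (isBijOn′ P r)
                   ≡ ∑[ p ← allFin (suc k) ] (𝟙 (isBijOn′ P′ r′) * 𝟙 (does (r ≗ʳ? insertAt p r′)))
    fibre-size r r′ = by-cases (deleteAt r ≗ʳ? r′) (isBijOn′ P r) refl
      where
      Fibre : ℤ
      Fibre = ∑[ p ← allFin (suc k) ] (𝟙 (isBijOn′ P′ r′) * 𝟙 (does (r ≗ʳ? insertAt p r′)))

      outside-fibre : ¬ (IsBijOn P r × deleteAt r ≗ r′) → 0ℤ ≡ Fibre
      outside-fibre ∉fibre =
        sym (trans (∑-cong (allFin (suc k)) (λ p → term p (isBijOn′ P′ r′) refl (r ≗ʳ? insertAt p r′)))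
                   (∑-zero (allFin (suc k))))
        where
        term : ∀ p b → isBijOn′ P′ r′ ≡ b → (D : Dec (r ≗ insertAt p r′)) → 𝟙 b * 𝟙 (does D) ≡ 0ℤ
        term p true  bij′ (yes r≗) = contradiction (insertAt-fibre p (isBijOn′-sound bij′) r≗) ∉fibre
        term p true  _    (no _)   = refl
        term p false _    _        = refl

      by-cases : (D : Dec (deleteAt r ≗ r′)) (b : Bool) → isBijOn′ P r ≡ b → 𝟙 (does D) * 𝟙 b ≡ Fibre
      by-cases (yes del≗) true  bij≡ = begin
        1ℤ                                             ≡⟨ sym (allFin-once b) ⟩
        ∑[ p ← allFin (suc k) ] 𝟙 (does (p Fin.≟ b))   ≡⟨ ∑-cong (allFin (suc k)) (λ p → sym (in-fibre p)) ⟩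
        Fibre                                          ∎
        where
        bij : IsBijOn P r
        bij = isBijOn′-sound bij≡
        b : Fin (suc k)
        b = proj₁ (IsBijOn.defined bij d∈P)
        rd : r d ≡ just b
        rd = proj₂ (IsBijOn.defined bij d∈P)
        bij′ : isBijOn′ P′ r′ ≡ true
        bij′ = isBijOn′-complete (IsBijOn-resp del≗ (deleteAt-bij bij rd))
        in-fibre : ∀ p → 𝟙 (isBijOn′ P′ r′) * 𝟙 (does (r ≗ʳ? insertAt p r′)) ≡ 𝟙 (does (p Fin.≟ b))
        in-fibre p = begin
          𝟙 (isBijOn′ P′ r′) * 𝟙 (does (r ≗ʳ? insertAt p r′))
            ≡⟨ cong (λ t → 𝟙 t * 𝟙 (does (r ≗ʳ? insertAt p r′))) bij′ ⟩
          1ℤ * 𝟙 (does (r ≗ʳ? insertAt p r′))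
            ≡⟨ *-identityˡ _ ⟩
          𝟙 (does (r ≗ʳ? insertAt p r′))
            ≡⟨ cong 𝟙 (does-⇔ (≗insertAt⇔ bij rd p del≗) (r ≗ʳ? insertAt p r′) (p Fin.≟ b)) ⟩
          𝟙 (does (p Fin.≟ b))
            ∎
      by-cases (yes del≗) false bij≡ = outside-fibre (λ (bij , _) → isBijOn′-false bij≡ bij)
      by-cases (no ¬del≗) b     _    = outside-fibre (λ (_ , del≗) → ¬del≗ del≗)

    fibre-count : ∀ r′ → ∑[ r ← allFuns n (allMaybe (suc k)) ] (𝟙 (does (deleteAt r ≗ʳ? r′)) * 𝟙 (isBijOn′ P r))
                           ≡ + suc k * 𝟙 (isBijOn′ P′ r′)
    fibre-count r′ = begin
      ∑[ r ← Rs ] (𝟙 (does (deleteAt r ≗ʳ? r′)) * 𝟙 (isBijOn′ P r))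
        ≡⟨ ∑-cong Rs (λ r → fibre-size r r′) ⟩
      ∑[ r ← Rs ] ∑[ p ← allFin (suc k) ] (𝟙 (isBijOn′ P′ r′) * 𝟙 (does (r ≗ʳ? insertAt p r′)))
        ≡⟨ ∑-comm Rs (allFin (suc k)) (λ r p → 𝟙 (isBijOn′ P′ r′) * 𝟙 (does (r ≗ʳ? insertAt p r′))) ⟩
      ∑[ p ← allFin (suc k) ] ∑[ r ← Rs ] (𝟙 (isBijOn′ P′ r′) * 𝟙 (does (r ≗ʳ? insertAt p r′)))
        ≡⟨ ∑-cong (allFin (suc k)) (λ p →
             ∑-*ˡ Rs (𝟙 (isBijOn′ P′ r′)) (λ r → 𝟙 (does (r ≗ʳ? insertAt p r′)))) ⟩
      ∑[ p ← allFin (suc k) ] (𝟙 (isBijOn′ P′ r′) * ∑[ r ← Rs ] 𝟙 (does (r ≗ʳ? insertAt p r′)))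
        ≡⟨ ∑-cong (allFin (suc k)) (λ p →
             trans (cong (𝟙 (isBijOn′ P′ r′) *_) (RankingFuns.allFuns-once (suc k) n (insertAt p r′)))
                   (*-identityʳ (𝟙 (isBijOn′ P′ r′)))) ⟩
      ∑[ p ← allFin (suc k) ] 𝟙 (isBijOn′ P′ r′)
        ≡⟨ ∑-const (allFin (suc k)) (𝟙 (isBijOn′ P′ r′)) ⟩
      + length (allFin (suc k)) * 𝟙 (isBijOn′ P′ r′)
        ≡⟨ cong (λ l → + l * 𝟙 (isBijOn′ P′ r′)) (length-tabulate {n = suc k} id) ⟩
      + suc k * 𝟙 (isBijOn′ P′ r′) ∎
      where
      Rs : List (Fin n → Maybe (Fin (suc k)))
      Rs = allFuns n (allMaybe (suc k))

    ∑-deleteAt : (H : (Fin n → Maybe (Fin (suc k))) → ℤ) (H′ : (Fin n → Maybe (Fin k)) → ℤ) →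
                 H′ Preserves _≗_ ⟶ _≡_ → (∀ {r} → IsBijOn P r → H r ≡ H′ (deleteAt r)) →
                 ∑[ r ← allFuns n (allMaybe (suc k)) ] (𝟙 (isBijOn′ P r) * H r)
                   ≡ + suc k * ∑[ r′ ← allFuns n (allMaybe k) ] (𝟙 (isBijOn′ P′ r′) * H′ r′)
    ∑-deleteAt H H′ H′-cong H≡H′∘deleteAt = begin
      ∑[ r ← Rs ] (𝟙 (isBijOn′ P r) * H r)
        ≡⟨ RankingFuns.∑-fibres k Rs deleteAt (λ r → 𝟙 (isBijOn′ P r) * H r) ⟩
      ∑[ r′ ← Rs′ ] ∑[ r ← Rs ] (𝟙 (does (deleteAt r ≗ʳ? r′)) * (𝟙 (isBijOn′ P r) * H r))
        ≡⟨ ∑-cong Rs′ (λ r′ → ∑-cong Rs (λ r → 𝟙*𝟙*-cong (deleteAt r ≗ʳ? r′) (isBijOn′ P r)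
             (λ del≗ bij → trans (H≡H′∘deleteAt (isBijOn′-sound bij)) (H′-cong del≗)))) ⟩
      ∑[ r′ ← Rs′ ] ∑[ r ← Rs ] ((𝟙 (does (deleteAt r ≗ʳ? r′)) * 𝟙 (isBijOn′ P r)) * H′ r′)
        ≡⟨ ∑-cong Rs′ (λ r′ → trans (∑-*ʳ Rs (H′ r′) _) (cong (_* H′ r′) (fibre-count r′))) ⟩
      ∑[ r′ ← Rs′ ] ((+ suc k * 𝟙 (isBijOn′ P′ r′)) * H′ r′)
        ≡⟨ ∑-cong Rs′ (λ r′ → *-assoc (+ suc k) (𝟙 (isBijOn′ P′ r′)) (H′ r′)) ⟩
      ∑[ r′ ← Rs′ ] (+ suc k * (𝟙 (isBijOn′ P′ r′) * H′ r′))
        ≡⟨ ∑-*ˡ Rs′ (+ suc k) (λ r′ → 𝟙 (isBijOn′ P′ r′) * H′ r′) ⟩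
      + suc k * ∑[ r′ ← Rs′ ] (𝟙 (isBijOn′ P′ r′) * H′ r′) ∎
      where
      Rs : List (Fin n → Maybe (Fin (suc k)))
      Rs = allFuns n (allMaybe (suc k))
      Rs′ : List (Fin n → Maybe (Fin k))
      Rs′ = allFuns n (allMaybe k)

_∖_ : ∀ {n} → (Fin n → Bool) → Fin n → Fin n → Bool
(Y ∖ i) j = Y j ∧ not ⌊ j Fin.≟ i ⌋

∖-comm : ∀ {n} (Y : Fin n → Bool) i d → (Y ∖ i) ∖ d ≗ (Y ∖ d) ∖ i
∖-comm Y i d j = trans (∧-assoc (Y j) _ _) (trans (cong (Y j ∧_) (∧-comm (not ⌊ j Fin.≟ i ⌋) _)) (sym (∧-assoc (Y j) _ _)))

∖-fresh : ∀ {n} (Y : Fin n → Bool) {d} → Y d ≡ false → Y ∖ d ≗ Y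
∖-fresh Y {d} Yd j = case j Fin.≟ d of λ where
  (yes refl) → trans (cong (_∧ _) Yd) (sym Yd)
  (no j≢d)   → trans (cong (λ t → Y j ∧ not t) (⌊⌋-false (j Fin.≟ d) j≢d)) (∧-identityʳ (Y j))

∖-⊆ : ∀ {n} (Y : Fin n → Bool) i j → (Y ∖ i) j ≡ true → Y j ≡ true
∖-⊆ Y i j with Y j
... | true  = λ _ → refl
... | false = λ ()

-- The indices of S^π_{≥ i} for the ranking r.
above : ∀ {n k} → (Fin n → Maybe (Fin k)) → Fin n → Fin n → Bool
above r i j = geq (r j) (r i)

above-deleteAt : ∀ {n k} {d i : Fin n} {P} {r : Fin n → Maybe (Fin (suc k))} {b} →
                 IsBijOn P r → r d ≡ just b → i ≢ d → above (deleteAt d r) i ≗ above r i ∖ d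
above-deleteAt {d = d} {i} {r = r} {b} bij rd i≢d j = by-cases (j Fin.≟ d)
  where
  r≢b : ∀ {j} → j ≢ d → r j ≢ just b
  r≢b j≢d rj = j≢d (IsBijOn.injective bij rj rd)
  deleted : ∀ {j} → j ≢ d → deleteAt d r j ≡ squeeze (just b) (r j)
  deleted {j} j≢d = trans (deleteAt-other d r j≢d) (cong (λ u → squeeze u (r j)) rd)
  by-cases : Dec (j ≡ d) → above (deleteAt d r) i j ≡ (above r i ∖ d) j
  by-cases (yes refl) = trans (cong (λ u → geq u (deleteAt d r i)) (deleteAt-self d r))
                              (sym (trans (cong (λ t → above r i d ∧ not t) (⌊⌋-true (d Fin.≟ d) refl)) (∧-zeroʳ _)))
  by-cases (no j≢d)   = begin
    geq (deleteAt d r j) (deleteAt d r i)                  ≡⟨ cong₂ geq (deleted j≢d) (deleted i≢d) ⟩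
    geq (squeeze (just b) (r j)) (squeeze (just b) (r i))  ≡⟨ squeeze-geq (r j) (r i) (r≢b j≢d) (r≢b i≢d) ⟩
    above r i j                                            ≡⟨ sym (∧-identityʳ _) ⟩
    above r i j ∧ true
      ≡⟨ cong (λ t → above r i j ∧ not t) (sym (⌊⌋-false (j Fin.≟ d) j≢d)) ⟩
    (above r i ∖ d) j                                      ∎

module Ranking {n : ℕ} (code : Fin n → ℕ) where

  below : Fin n → Subset n
  below a = Vec.tabulate (λ c → ⌊ code c ℕ.<? code a ⌋)

  ∈-below⁺ : ∀ {a c} → code c ℕ.< code a → c ∈ below a
  ∈-below⁺ {a} {c} lt = Vec.lookup⇒[]= c (below a) (trans (Vec.lookup∘tabulate _ c) (⌊⌋-true (code c ℕ.<? code a) lt))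

  ∈-below⁻ : ∀ {a c} → c ∈ below a → code c ℕ.< code a
  ∈-below⁻ {a} {c} c∈ = toWitness {a? = code c ℕ.<? code a}
    (Equivalence.from T-≡ (trans (sym (Vec.lookup∘tabulate _ c)) (Vec.[]=⇒lookup c∈)))

  ∉-below : ∀ a → a ∉ below a
  ∉-below a a∈a = ℕ.<-irrefl refl (∈-below⁻ a∈a)

  below-⊂ : ∀ {a b} → code a ℕ.< code b → below a ⊂ below b
  below-⊂ {a} lt = (λ c∈a → ∈-below⁺ (ℕ.<-trans (∈-below⁻ c∈a) lt)) , a , ∈-below⁺ lt , ∉-below a

  ∣below∣<n : ∀ a → ∣ below a ∣ ℕ.< n
  ∣below∣<n a = subst (∣ below a ∣ ℕ.<_) (∣⊤∣≡n n) (p⊂q⇒∣p∣<∣q∣ (⊆⊤ , a , ∈⊤ , ∉-below a))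

  rank : Fin n → Fin n
  rank a = Fin.fromℕ< (∣below∣<n a)

  rank-< : ∀ {a b} → code a ℕ.< code b → rank a Fin.< rank b
  rank-< {a} {b} lt = subst₂ ℕ._<_ (sym (Fin.toℕ-fromℕ< (∣below∣<n a))) (sym (Fin.toℕ-fromℕ< (∣below∣<n b)))
                                   (p⊂q⇒∣p∣<∣q∣ (below-⊂ lt))

  module _ (code-injective : ∀ {a b} → code a ≡ code b → a ≡ b) where

    rank-injective : ∀ {a b} → rank a ≡ rank b → a ≡ b
    rank-injective {a} {b} eq with ℕ.<-cmp (code a) (code b)
    ... | tri< lt _ _ = contradiction (rank-< lt) (ℕ.<-irrefl (cong Fin.toℕ eq))
    ... | tri≈ _ e _  = code-injective e
    ... | tri> _ _ gt = contradiction (rank-< gt) (ℕ.<-irrefl (cong Fin.toℕ (sym eq)))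

    rank-≤⇔ : ∀ {a b} → rank a Fin.≤ rank b ⇔ code a ℕ.≤ code b
    rank-≤⇔ {a} {b} = mk⇔ (λ le → ℕ.≮⇒≥ (λ gt → ℕ.<⇒≱ (rank-< gt) le)) from
      where
      from : code a ℕ.≤ code b → rank a Fin.≤ rank b
      from le with ℕ.m≤n⇒m<n∨m≡n le
      ... | inj₁ lt = ℕ.<⇒≤ (rank-< lt)
      ... | inj₂ e  = ℕ.≤-reflexive (cong (Fin.toℕ ∘ rank) (code-injective e))

-- The permutation ranking the complement of Y first, then d, then the rest of Y.
module Realising {n : ℕ} (d : Fin n) (Y : Fin n → Bool) (Yd : Y d ≡ true) where

  key : Fin n → ℕ
  key j = if ⌊ j Fin.≟ d ⌋ then 1 else if Y j then 2 else 0

  code : Fin n → ℕ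
  code j = Fin.toℕ j ℕ.+ key j ℕ.* n

  open Ranking code

  private instance
    n≢0 : ℕ.NonZero n
    n≢0 = Fin.nonZeroIndex d

  code-injective : ∀ {a b} → code a ≡ code b → a ≡ b
  code-injective {a} {b} eq = Fin.toℕ-injective (begin
    Fin.toℕ a       ≡⟨ sym (m<n⇒m%n≡m (Fin.toℕ<n a)) ⟩
    Fin.toℕ a % n   ≡⟨ sym ([m+kn]%n≡m%n (Fin.toℕ a) (key a) n) ⟩
    code a % n      ≡⟨ cong (_% n) eq ⟩
    code b % n      ≡⟨ [m+kn]%n≡m%n (Fin.toℕ b) (key b) n ⟩
    Fin.toℕ b % n   ≡⟨ m<n⇒m%n≡m (Fin.toℕ<n b) ⟩
    Fin.toℕ b       ∎)

  code-d : code d ≡ Fin.toℕ d ℕ.+ 1 ℕ.* n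
  code-d = cong (λ t → Fin.toℕ d ℕ.+ (if t then 1 else if Y d then 2 else 0) ℕ.* n) (⌊⌋-true (d Fin.≟ d) refl)

  code-other : ∀ {j} b → j ≢ d → Y j ≡ b → code j ≡ Fin.toℕ j ℕ.+ (if b then 2 else 0) ℕ.* n
  code-other {j} b j≢d Yj = cong₂ (λ t u → Fin.toℕ j ℕ.+ (if t then 1 else if u then 2 else 0) ℕ.* n)
                                  (⌊⌋-false (j Fin.≟ d) j≢d) Yj

  code-d≤⇔ : ∀ j → code d ℕ.≤ code j ⇔ Y j ≡ true
  code-d≤⇔ j = by-cases (j Fin.≟ d) (Y j) refl
    where
    by-cases : Dec (j ≡ d) → ∀ b → Y j ≡ b → code d ℕ.≤ code j ⇔ Y j ≡ true
    by-cases (yes refl) _     _  = mk⇔ (λ _ → Yd) (λ _ → ℕ.≤-refl)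
    by-cases (no j≢d)   true  Yj = mk⇔ (λ _ → Yj) λ _ → subst₂ ℕ._≤_ (sym code-d) (sym (code-other true j≢d Yj))
      (ℕ.≤-trans (ℕ.+-monoˡ-≤ (1 ℕ.* n) (ℕ.<⇒≤ (Fin.toℕ<n d))) (ℕ.m≤n+m (n ℕ.+ 1 ℕ.* n) (Fin.toℕ j)))
    by-cases (no j≢d)   false Yj =
      mk⇔ (λ le → contradiction le (ℕ.<⇒≱ code-j<code-d)) (λ Yj′ → contradiction (trans (sym Yj) Yj′) λ ())
      where
      code-j<code-d : code j ℕ.< code d
      code-j<code-d = subst₂ ℕ._<_ (sym (code-other false j≢d Yj)) (sym code-d)
        (ℕ.<-≤-trans (subst (ℕ._< n) (sym (ℕ.+-identityʳ (Fin.toℕ j))) (Fin.toℕ<n j))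
                     (ℕ.≤-trans (ℕ.m≤m+n n 0) (ℕ.m≤n+m (1 ℕ.* n) (Fin.toℕ d))))

  above-realised : ∃ λ (π : Fin n → Fin n) → isInjective π ≡ true × above (just ∘ π) d ≗ Y
  above-realised = rank , isInjective-complete (rank-injective code-injective) , λ j →
    ⌊⌋-reflects (rank d Fin.≤? rank j)
      (mk⇔ (Equivalence.to (code-d≤⇔ j) ∘ Equivalence.to (rank-≤⇔ code-injective {d} {j}))
           (Equivalence.from (rank-≤⇔ code-injective {d} {j}) ∘ Equivalence.from (code-d≤⇔ j)))

-- Values of games

module _ {m : ℕ} (G : Game m) where
  open Game G

  -- Sat plays σ on T and any legal move on the other states of T′.
  SatWins-mono : ∀ {T T′} → (∀ s → T s ≡ true → T′ s ≡ true) → SatWins G T → SatWins G T′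
  SatWins-mono {T} {T′} T⊆T′ (σ , legal , wins) =
    σ′ , legal′ , λ ρ play consistent′ → wins ρ play (consistent consistent′)
    where
    σ′ : Strategy G
    σ′ h s = if T s then σ h s else proj₁ (total s)
    legal′ : Legal G T′ σ′
    legal′ h s _ with T s in Ts
    ... | true  = legal h s Ts
    ... | false = proj₂ (total s)
    consistent : ∀ {ρ} → Consistent G T′ σ′ ρ → Consistent G T σ ρ
    consistent {ρ} consistent′ k Tρk with consistent′ k (T⊆T′ (ρ k) Tρk)
    ... | step rewrite Tρk = step

  module _ {val : (Fin m → Bool) → ℤ} (isVal : IsVal G val) where

    val-mono : ∀ {T T′} → (∀ s → T s ≡ true → T′ s ≡ true) → val T ℤ.≤ val T′
    val-mono {T} {T′} T⊆T′ with isVal T | isVal T′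
    ... | inj₁ (v , _) | inj₁ (v′ , _)  = ≤-reflexive (trans v (sym v′))
    ... | inj₂ (v , _) | inj₂ (v′ , _)  = ≤-reflexive (trans v (sym v′))
    ... | inj₂ (v , _) | inj₁ (v′ , _)  = subst₂ ℤ._≤_ (sym v) (sym v′) (ℤ.+≤+ z≤n)
    ... | inj₁ (_ , w) | inj₂ (_ , ¬w′) = contradiction (SatWins-mono T⊆T′ w) ¬w′

    val-cong : ∀ {T T′} → T ≗ T′ → val T ≡ val T′
    val-cong T≗T′ = ≤-antisym (val-mono (λ s Ts → trans (sym (T≗T′ s)) Ts))
                              (val-mono (λ s T′s → trans (T≗T′ s) T′s))

module _ {m n : ℕ} (block : Fin m → Maybe (Fin n)) where

  ⋃ : (Fin n → Bool) → Fin m → Bool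
  ⋃ Y s with block s
  ... | just j  = Y j
  ... | nothing = false

  ⋃-cong : ∀ {Y Y′} → Y ≗ Y′ → ⋃ Y ≗ ⋃ Y′
  ⋃-cong Y≗Y′ s with block s
  ... | just j  = Y≗Y′ j
  ... | nothing = refl

  ⋃-mono : ∀ {Y Y′} → (∀ j → Y j ≡ true → Y′ j ≡ true) → ∀ s → ⋃ Y s ≡ true → ⋃ Y′ s ≡ true
  ⋃-mono Y⊆Y′ s with block s
  ... | just j  = Y⊆Y′ j
  ... | nothing = λ ()

module Contributions {m : ℕ} (G : Game m) {val : (Fin m → Bool) → ℤ} (isVal : IsVal G val) {n : ℕ}
                     (block : Fin m → Maybe (Fin n)) where

  contribution : (Fin n → Bool) → Fin n → ℤ
  contribution Y i = val (⋃ block Y) - val (⋃ block (Y ∖ i))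

  contribution-cong : ∀ {Y Y′} i → Y ≗ Y′ → contribution Y i ≡ contribution Y′ i
  contribution-cong i Y≗Y′ = cong₂ _-_ (val-cong G isVal (⋃-cong block Y≗Y′))
                                       (val-cong G isVal (⋃-cong block (λ j → cong (_∧ _) (Y≗Y′ j))))

  contribution-nonneg : ∀ Y i → 0ℤ ℤ.≤ contribution Y i
  contribution-nonneg Y i = i≤j⇒0≤j-i (val-mono G isVal (⋃-mono block (∖-⊆ Y i)))

  marginal≡contribution : ∀ {k} (r : Fin n → Maybe (Fin k)) i → marginal val block r i ≡ contribution (above r i) i
  marginal≡contribution r i = cong₂ _-_ (val-cong G isVal upSet-⋃) (val-cong G isVal upSetMinus-⋃)
    where
    upSet-⋃ : upSet block r i ≗ ⋃ block (above r i)
    upSet-⋃ s with block s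
    ... | just j  = refl
    ... | nothing = refl
    upSetMinus-⋃ : upSetMinus block r i ≗ ⋃ block (above r i ∖ i)
    upSetMinus-⋃ s with block s
    ... | just j  = refl
    ... | nothing = refl

  marginal-cong : ∀ {k} {r r′ : Fin n → Maybe (Fin k)} i → r ≗ r′ → marginal val block r i ≡ marginal val block r′ i
  marginal-cong {r = r} {r′} i r≗r′ = begin
    marginal val block r i      ≡⟨ marginal≡contribution r i ⟩
    contribution (above r i) i  ≡⟨ contribution-cong i (λ j → cong₂ geq (r≗r′ j) (r≗r′ i)) ⟩
    contribution (above r′ i) i ≡⟨ sym (marginal≡contribution r′ i) ⟩
    marginal val block r′ i     ∎

  IsDummy : Fin n → Set
  IsDummy d = ∀ Y → val (⋃ block Y) ≡ val (⋃ block (Y ∖ d))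

  dummy-contribution : ∀ {d} → IsDummy d → ∀ Y i → contribution (Y ∖ d) i ≡ contribution Y i
  dummy-contribution {d} dummy Y i =
    sym (cong₂ _-_ (dummy Y) (trans (dummy (Y ∖ i)) (val-cong G isVal (⋃-cong block (∖-comm Y i d)))))

  marginal-deleteAt : ∀ {d i k} {P} {r : Fin n → Maybe (Fin (suc k))} → IsDummy d → i ≢ d →
                      IsBijOn P r → P d ≡ true → marginal val block r i ≡ marginal val block (deleteAt d r) i
  marginal-deleteAt {d} {i} {r = r} dummy i≢d bij d∈P = begin
    marginal val block r i                  ≡⟨ marginal≡contribution r i ⟩
    contribution (above r i) i              ≡⟨ sym (dummy-contribution dummy (above r i) i) ⟩
    contribution (above r i ∖ d) i          ≡⟨ contribution-cong i (sym ∘ above-deleteAt bij rd i≢d) ⟩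
    contribution (above (deleteAt d r) i) i ≡⟨ sym (marginal≡contribution (deleteAt d r) i) ⟩
    marginal val block (deleteAt d r) i     ∎
    where
    rd : r d ≡ just (proj₁ (IsBijOn.defined bij d∈P))
    rd = proj₂ (IsBijOn.defined bij d∈P)

  -- Marginals are non-negative, so a zero sum forces all of them to vanish.
  dummy-if-unimportant : ∀ d → ∑[ π ← Perms n ] marginal val block (just ∘ π) d ≡ 0ℤ → IsDummy d
  dummy-if-unimportant d ∑≡0 Y = by-cases (Y d) refl
    where
    M : (Fin n → Fin n) → ℤ
    M π = 𝟙 (isInjective π) * marginal val block (just ∘ π) d

    M≡0 : ∀ π → M π ≡ 0ℤ
    M≡0 = FinFuns.allFuns-nonneg-zero n M
      (λ π≗π′ → cong₂ (λ b x → 𝟙 b * x) (isInjective-cong π≗π′) (marginal-cong d (cong just ∘ π≗π′)))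
      (λ π → 𝟙*-nonneg (isInjective π)
               (≤-trans (contribution-nonneg _ d) (≤-reflexive (sym (marginal≡contribution (just ∘ π) d)))))
      (trans (sym (∑-filterᵇ isInjective (allFuns n (allFin n)) (λ π → marginal val block (just ∘ π) d))) ∑≡0)

    by-cases : ∀ b → Y d ≡ b → val (⋃ block Y) ≡ val (⋃ block (Y ∖ d))
    by-cases false Yd = sym (val-cong G isVal (⋃-cong block (∖-fresh Y Yd)))
    by-cases true  Yd = i-j≡0⇒i≡j _ _ (begin
      contribution Y d                      ≡⟨ contribution-cong d (sym ∘ π-above) ⟩
      contribution (above (just ∘ π) d) d   ≡⟨ sym (marginal≡contribution (just ∘ π) d) ⟩
      marginal val block (just ∘ π) d       ≡⟨ sym (*-identityˡ _) ⟩
      1ℤ * marginal val block (just ∘ π) d  ≡⟨ cong (λ b → 𝟙 b * marginal val block (just ∘ π) d) (sym π-injective) ⟩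
      M π                                   ≡⟨ M≡0 π ⟩
      0ℤ                                    ∎)
      where
      open Realising d Y Yd using (above-realised)
      π : Fin n → Fin n
      π = proj₁ above-realised
      π-injective : isInjective π ≡ true
      π-injective = proj₁ (proj₂ above-realised)
      π-above : above (just ∘ π) d ≗ Y
      π-above = proj₂ (proj₂ above-realised)

addTo : ∀ {n} → Fin n → (Fin n → Bool) → Fin n → Bool
addTo d P j = P j ∨ ⌊ j Fin.≟ d ⌋

addAll : ∀ {n} → List (Fin n) → (Fin n → Bool) → Fin n → Bool
addAll L P = foldr addTo P L

addAll-fresh : ∀ {n} {P : Fin n → Bool} {d} L → P d ≡ false → All (d ≢_) L → addAll L P d ≡ false
addAll-fresh []      Pd []          = Pd
addAll-fresh (x ∷ L) Pd (d≢x ∷ d∉L) = cong₂ _∨_ (addAll-fresh L Pd d∉L) (⌊⌋-false (_ Fin.≟ x) d≢x)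

addAll-⊇ : ∀ {n} {P : Fin n → Bool} {j} L → P j ≡ true → addAll L P j ≡ true
addAll-⊇ []      Pj = Pj
addAll-⊇ (x ∷ L) Pj = cong (_∨ _) (addAll-⊇ L Pj)

addAll-∈ : ∀ {n} {P : Fin n → Bool} {j} L → Any (j ≡_) L → addAll L P j ≡ true
addAll-∈ (x ∷ L) (here refl) = trans (cong (addAll L _ x ∨_) (⌊⌋-true (x Fin.≟ x) refl)) (∨-zeroʳ _)
addAll-∈ (x ∷ L) (there j∈L) = cong (_∨ _) (addAll-∈ L j∈L)

outsiders : ∀ {n} → Subset n → List (Fin n)
outsiders []          = []
outsiders (true ∷ p)  = map suc (outsiders p)
outsiders (false ∷ p) = zero ∷ map suc (outsiders p)

outsiders-unique : ∀ {n} (p : Subset n) → Unique (outsiders p)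
outsiders-unique []          = []
outsiders-unique (true ∷ p)  = Unique.map⁺ Fin.suc-injective (outsiders-unique p)
outsiders-unique (false ∷ p) =
  All.map⁺ (All.universal (λ _ ()) (outsiders p)) ∷ Unique.map⁺ Fin.suc-injective (outsiders-unique p)

outsiders-outside : ∀ {n} (p : Subset n) → All (λ j → lookup p j ≡ false) (outsiders p)
outsiders-outside []          = []
outsiders-outside (true ∷ p)  = All.map⁺ (outsiders-outside p)
outsiders-outside (false ∷ p) = refl ∷ All.map⁺ (outsiders-outside p)

outsiders-complete : ∀ {n} (p : Subset n) j → lookup p j ≡ false → Any (j ≡_) (outsiders p)
outsiders-complete (true ∷ p)  (suc j) pj = Any.map⁺ (Any.map (cong suc) (outsiders-complete p j pj))
outsiders-complete (false ∷ p) zero    _  = here refl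
outsiders-complete (false ∷ p) (suc j) pj = there (Any.map⁺ (Any.map (cong suc) (outsiders-complete p j pj)))

length-outsiders : ∀ {n} (p : Subset n) → length (outsiders p) ℕ.+ ∣ p ∣ ≡ n
length-outsiders []          = refl
length-outsiders (true ∷ p)  =
  trans (ℕ.+-suc _ ∣ p ∣) (cong suc (trans (cong (ℕ._+ ∣ p ∣) (length-map suc (outsiders p))) (length-outsiders p)))
length-outsiders (false ∷ p) = cong suc (trans (cong (ℕ._+ ∣ p ∣) (length-map suc (outsiders p))) (length-outsiders p))

module RankedSums {m : ℕ} (G : Game m) {val : (Fin m → Bool) → ℤ} (isVal : IsVal G val) {n : ℕ}
                  (block : Fin m → Maybe (Fin n)) (i : Fin n) where
  open Contributions G isVal block

  rankedSum : (Fin n → Bool) → ℕ → ℤ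
  rankedSum P k = ∑[ r ← allFuns n (allMaybe k) ] (𝟙 (isBijOn′ P r) * marginal val block r i)

  rankedSum-addTo : ∀ {d P k} → IsDummy d → i ≢ d → P d ≡ false →
                    rankedSum (addTo d P) (suc k) ≡ + suc k * rankedSum P k
  rankedSum-addTo {d} {P} dummy i≢d Pd =
    ∑-deleteAt d d∈ Pd P≗ (λ r → marginal val block r i) (λ r → marginal val block r i) (marginal-cong i)
      (λ bij → marginal-deleteAt dummy i≢d bij d∈)
    where
    d∈ : addTo d P d ≡ true
    d∈ = trans (cong (P d ∨_) (⌊⌋-true (d Fin.≟ d) refl)) (∨-zeroʳ (P d))
    P≗ : ∀ {j} → j ≢ d → addTo d P j ≡ P j
    P≗ {j} j≢d = trans (cong (P j ∨_) (⌊⌋-false (j Fin.≟ d) j≢d)) (∨-identityʳ (P j))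

  rankedSum-addAll : ∀ {P k} L → Unique L → All (λ d → IsDummy d × i ≢ d × P d ≡ false) L →
                     rankedSum (addAll L P) (length L ℕ.+ k) * + (k !) ≡ + ((length L ℕ.+ k) !) * rankedSum P k
  rankedSum-addAll {P} {k} []      _              _ = *-comm (rankedSum P k) (+ (k !))
  rankedSum-addAll {P} {k} (d ∷ L) (d∉L ∷ unique) ((dummy , i≢d , Pd) ∷ dummies) = begin
    rankedSum (addTo d (addAll L P)) (suc K) * + (k !)
      ≡⟨ cong (_* + (k !)) (rankedSum-addTo dummy i≢d (addAll-fresh L Pd d∉L)) ⟩
    (+ suc K * rankedSum (addAll L P) K) * + (k !)     ≡⟨ *-assoc (+ suc K) (rankedSum (addAll L P) K) (+ (k !)) ⟩
    + suc K * (rankedSum (addAll L P) K * + (k !))     ≡⟨ cong (+ suc K *_) (rankedSum-addAll L unique dummies) ⟩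
    + suc K * (+ (K !) * rankedSum P k)                ≡⟨ sym (*-assoc (+ suc K) (+ (K !)) (rankedSum P k)) ⟩
    (+ suc K * + (K !)) * rankedSum P k                ≡⟨ cong (_* rankedSum P k) (sym (pos-* (suc K) (K !))) ⟩
    + (suc K !) * rankedSum P k                        ∎
    where
    K : ℕ
    K = length L ℕ.+ k

/-≡0 : ∀ a c .{{_ : ℕ.NonZero c}} → a / c ≡ 0ℚ → a ≡ 0ℤ
/-≡0 a (suc c) eq with fromℚᵘ-injective {mkℚᵘ a c} {mkℚᵘ 0ℤ 0} eq
... | *≡* a*1≡0 = trans (sym (*-identityʳ a)) a*1≡0

/-cross : ∀ a b c d .{{_ : ℕ.NonZero c}} .{{_ : ℕ.NonZero d}} → a * + d ≡ b * + c → a / c ≡ b / d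
/-cross a b (suc c) (suc d) eq = fromℚᵘ-cong {mkℚᵘ a c} {mkℚᵘ b d} (*≡* eq)

mainTheorem2 : ∀ {m n : ℕ} (G : Game m) (block : Fin m → Maybe (Fin n))
    → IsPartition G block
    → (val : (Fin m → Bool) → ℤ) → IsVal G val
    → (I : Subset n)
    → (∀ j → j ∉ I → importance val block j ≡ 0ℚ)
    → ∀ i → i ∈ I → importance val block i ≡ importanceOn val block I ∣ I ∣ i
mainTheorem2 {m} {n} G block _ val isVal I unimportant i i∈I =
  /-cross sumPerms sumBijs (n !) (∣ I ∣ !) {{n !≢0}} {{∣ I ∣ !≢0}} (begin
    sumPerms * + (∣ I ∣ !)                           ≡⟨ cong (_* + (∣ I ∣ !)) sumPerms-ranked ⟩
    rankedSum (addAll L (lookup I)) n * + (∣ I ∣ !)  ≡⟨ dummies-removed ⟩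
    + (n !) * rankedSum (lookup I) ∣ I ∣             ≡⟨ cong (+ (n !) *_) (sym sumBijs-ranked) ⟩
    + (n !) * sumBijs                                ≡⟨ *-comm (+ (n !)) sumBijs ⟩
    sumBijs * + (n !)                                ∎)
  where
  open Contributions G isVal block
  open RankedSums G isVal block i
  sumPerms sumBijs : ℤ
  sumPerms = ∑[ π ← Perms n ] marginal val block (just ∘ π) i
  sumBijs  = ∑[ r ← BijsOn I ∣ I ∣ ] marginal val block r i
  L : List (Fin n)
  L = outsiders I
  ∉I : ∀ {d} → lookup I d ≡ false → d ∉ I
  ∉I Id d∈I = contradiction (trans (sym Id) (Vec.[]=⇒lookup d∈I)) λ ()
  dummy : ∀ {d} → lookup I d ≡ false → IsDummy d × i ≢ d × lookup I d ≡ false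
  dummy {d} Id = dummy-if-unimportant d (/-≡0 _ (n !) {{n !≢0}} (unimportant d (∉I Id)))
               , (λ { refl → ∉I Id i∈I })
               , Id
  everything : ∀ j → addAll L (lookup I) j ≡ true
  everything j with lookup I j in Ij
  ... | true  = addAll-⊇ L Ij
  ... | false = addAll-∈ L (outsiders-complete I j Ij)
  sumPerms-ranked : sumPerms ≡ rankedSum (addAll L (lookup I)) n
  sumPerms-ranked = ∑-Perms everything (λ r → marginal val block r i) (marginal-cong i)
  sumBijs-ranked : sumBijs ≡ rankedSum (lookup I) ∣ I ∣
  sumBijs-ranked = ∑-filterᵇ (isBijOn I) (allFuns n (allMaybe ∣ I ∣)) (λ r → marginal val block r i)
  dummies-removed : rankedSum (addAll L (lookup I)) n * + (∣ I ∣ !) ≡ + (n !) * rankedSum (lookup I) ∣ I ∣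
  dummies-removed = subst (λ k → rankedSum (addAll L (lookup I)) k * + (∣ I ∣ !) ≡ + (k !) * rankedSum (lookup I) ∣ I ∣)
                          (length-outsiders I) (rankedSum-addAll L (outsiders-unique I) (All.map dummy (outsiders-outside I)))
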